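{- For all conditional propositions $X,Y$: $\vdash\lfloor(X\wedge[X]Y)\leftrightarrow(X\wedge Y)\rfloor$.
   Context: $\mathcal{C}$: smallest set containing $\bot$ and a set of atoms, closed under $X\to Y$ and $[X]Y$; $\neg X:=X\to\bot$, $X\vee Y:=\neg X\to Y$, $X\wedge Y:=\neg(\neg X\vee\neg Y)$, $\top:=\neg\bot$, $X\leftrightarrow Y:=(X\to Y)\wedge(Y\to X)$. Bayesian propositions $\lfloor X_1|\cdots|X_n\rfloor$ ($n\ge1$); $\Gamma,\Delta$ finite possibly empty sequences. Proof system: axioms $\lfloor A\rfloor$ for instances over $\mathcal{C}$ of a standard Hilbert system for classical propositional logic; $\lfloor[X](Y\to Z)\to([X]Y\to[X]Z)\rfloor$; $\lfloor[X]Y\to(X\to Y)\rfloor$; $\lfloor[X]\neg Y\leftrightarrow\neg[X]Y\rfloor$. Rules: from $\lfloor\Gamma|X\rfloor$, $\lfloor\Delta|X\to Y\rfloor$ infer $\lfloor\Gamma|\Delta|Y\rfloor$; permutation of components; from $\lfloor\Gamma|X|X\rfloor$ infer $\lfloor\Gamma|X\rfloor$; from $\lfloor\Gamma\rfloor$ infer $\lfloor\Gamma|X\rfloor$; from $\lfloor\Gamma|X\to Y\rfloor$ infer $\lfloor\Gamma|\neg X|[X]Y\rfloor$; from $\lfloor\Gamma|Y\leftrightarrow\neg X\rfloor$, $\lfloor\Gamma|[X]Z\leftrightarrow Z\rfloor$ infer $\lfloor\Gamma|[Y]Z\leftrightarrow Z\rfloor$. $\vdash$ means derivable. -}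

module Defs where

open import Data.List using (List; []; _∷_; _++_; [_])
open import Data.List.Relation.Binary.Permutation.Propositional using (_↭_)

data Cond (Atom : Set) : Set where
  atom : Atom → Cond Atom
  ⊥c   : Cond Atom
  _⇒_  : Cond Atom → Cond Atom → Cond Atom
  ⟦_⟧_ : Cond Atom → Cond Atom → Cond Atom

infixr 5 _⇒_
infixr 6 ⟦_⟧_

module _ {Atom : Set} where
  ¬c_ : Cond Atom → Cond Atom
  ¬c X = X ⇒ ⊥c

  _∨c_ : Cond Atom → Cond Atom → Cond Atom
  X ∨c Y = (¬c X) ⇒ Y

  _∧c_ : Cond Atom → Cond Atom → Cond Atom
  X ∧c Y = ¬c ((¬c X) ∨c (¬c Y))

  ⊤c : Cond Atom
  ⊤c = ¬c ⊥c

  _⇔_ : Cond Atom → Cond Atom → Cond Atom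
  X ⇔ Y = (X ⇒ Y) ∧c (Y ⇒ X)

-- A Bayesian proposition ⌊X₁|…|Xₙ⌋ is represented by the list X₁ ∷ … ∷ Xₙ ∷ [].
-- Classical base: Łukasiewicz's Hilbert system (axioms A1–A3, modus ponens
-- being the first rule with Γ, Δ empty), with ¬X := X → ⊥.
data ⊢_ {Atom : Set} : List (Cond Atom) → Set where
  ax1 : ∀ X Y → ⊢ [ X ⇒ (Y ⇒ X) ]
  ax2 : ∀ X Y Z → ⊢ [ (X ⇒ (Y ⇒ Z)) ⇒ ((X ⇒ Y) ⇒ (X ⇒ Z)) ]
  ax3 : ∀ X Y → ⊢ [ ((¬c X) ⇒ (¬c Y)) ⇒ (Y ⇒ X) ]
  axK : ∀ X Y Z → ⊢ [ (⟦ X ⟧ (Y ⇒ Z)) ⇒ ((⟦ X ⟧ Y) ⇒ (⟦ X ⟧ Z)) ]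
  axT : ∀ X Y → ⊢ [ (⟦ X ⟧ Y) ⇒ (X ⇒ Y) ]
  axN : ∀ X Y → ⊢ [ (⟦ X ⟧ (¬c Y)) ⇔ (¬c (⟦ X ⟧ Y)) ]
  mp   : ∀ Γ Δ X Y → ⊢ (Γ ++ [ X ]) → ⊢ (Δ ++ [ X ⇒ Y ]) → ⊢ (Γ ++ Δ ++ [ Y ])
  perm : ∀ Γ Γ' → Γ ↭ Γ' → ⊢ Γ → ⊢ Γ'
  contr : ∀ Γ X → ⊢ (Γ ++ X ∷ X ∷ []) → ⊢ (Γ ++ [ X ])
  weak : ∀ Γ X → ⊢ Γ → ⊢ (Γ ++ [ X ])
  cond : ∀ Γ X Y → ⊢ (Γ ++ [ X ⇒ Y ]) → ⊢ (Γ ++ (¬c X) ∷ (⟦ X ⟧ Y) ∷ [])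
  indep : ∀ Γ X Y Z → ⊢ (Γ ++ [ Y ⇔ (¬c X) ]) → ⊢ (Γ ++ [ (⟦ X ⟧ Z) ⇔ Z ])
        → ⊢ (Γ ++ [ (⟦ Y ⟧ Z) ⇔ Z ])

-- Only one-component Bayesian propositions ⌊A⌋ occur, and for these the
-- proof system restricts to a classical Hilbert calculus (Łukasiewicz's
-- axioms and modus ponens) enlarged by the conditional axioms K, T and N.  The theorem then splits into its two
-- directions:  X ∧ [X]Y ⊢ Y by detachment, and X ∧ Y ⊢ [X]Y because
-- ¬[X]Y would give [X]¬Y and hence ¬Y by detachment.
module Submission where

open import Defs
open import Data.List using (List; []; _∷_; [_])
open import Data.List.Membership.Propositional using (_∈_)
open import Data.List.Relation.Unary.Any using (here; there)
open import Relation.Binary.PropositionalEquality using (refl)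

module _ {Atom : Set} where

  Theorem : Cond Atom → Set
  Theorem A = ⊢ [ A ]

  modusPonens : ∀ {A B} → Theorem A → Theorem (A ⇒ B) → Theorem B
  modusPonens {A} {B} a ab = mp [] [] A B a ab

  -- A ⇒ A, the usual S K K derivation.
  ⇒-refl : ∀ A → Theorem (A ⇒ A)
  ⇒-refl A = modusPonens (ax1 A A) (modusPonens (ax1 A (A ⇒ A)) (ax2 A (A ⇒ A) A))

  infix 4 _⊩_
  data _⊩_ (Γ : List (Cond Atom)) : Cond Atom → Set where
    hyp : ∀ {A} → A ∈ Γ → Γ ⊩ A
    thm : ∀ {A} → Theorem A → Γ ⊩ A
    app : ∀ {A B} → Γ ⊩ A ⇒ B → Γ ⊩ A → Γ ⊩ B

  var₀ : ∀ {Γ A} → A ∷ Γ ⊩ A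
  var₀ = hyp (here refl)

  var₁ : ∀ {Γ A B} → B ∷ A ∷ Γ ⊩ A
  var₁ = hyp (there (here refl))

  var₂ : ∀ {Γ A B C} → C ∷ B ∷ A ∷ Γ ⊩ A
  var₂ = hyp (there (there (here refl)))

  weaken : ∀ {Γ A B} → Γ ⊩ A → B ∷ Γ ⊩ A
  weaken (hyp a)   = hyp (there a)
  weaken (thm t)   = thm t
  weaken (app f a) = app (weaken f) (weaken a)

  deduction : ∀ {Γ A B} → A ∷ Γ ⊩ B → Γ ⊩ A ⇒ B
  deduction {A = A}         (hyp (here refl))         = thm (⇒-refl A)
  deduction {A = A} {B = B} (hyp (there b))           = app (thm (ax1 B A)) (hyp b)
  deduction {A = A} {B = B} (thm t)                   = app (thm (ax1 B A)) (thm t)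
  deduction {A = A}         (app {A = B} {B = C} f b) =
    app (app (thm (ax2 A B C)) (deduction f)) (deduction b)

  discharge : ∀ {A} → [] ⊩ A → Theorem A
  discharge (hyp ())
  discharge (thm t)   = t
  discharge (app f a) = modusPonens (discharge a) (discharge f)

  -- Ex falso quodlibet, from A3 applied to ¬A ⇒ ¬⊥.
  exFalso : ∀ {Γ} A → Γ ⊩ ⊥c → Γ ⊩ A
  exFalso A absurd = app (app (thm (ax3 A ⊥c)) (deduction (deduction var₀))) absurd

  -- Double negation elimination, from A3 applied to ¬A ⇒ ¬⊤.
  ¬¬-elim : ∀ {Γ} A → Γ ⊩ ¬c (¬c A) → Γ ⊩ A
  ¬¬-elim A ¬¬a =
    app (app (thm (ax3 A ⊤c)) (deduction (exFalso (¬c ⊤c) (app (weaken ¬¬a) var₀))))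
        (deduction var₀)

  -- Rules for the defined conjunction A ∧ B = ¬(¬¬A ⇒ ¬B).
  ∧-intro : ∀ {Γ A B} → Γ ⊩ A → Γ ⊩ B → Γ ⊩ A ∧c B
  ∧-intro a b = deduction (app (app var₀ (deduction (app var₀ (weaken (weaken a))))) (weaken b))

  ∧-elimˡ : ∀ {Γ} A B → Γ ⊩ A ∧c B → Γ ⊩ A
  ∧-elimˡ A B a∧b = ¬¬-elim A (deduction (app (weaken a∧b) (deduction (deduction (app var₁ var₂)))))

  ∧-elimʳ : ∀ {Γ} A B → Γ ⊩ A ∧c B → Γ ⊩ B
  ∧-elimʳ A B a∧b = ¬¬-elim B (deduction (app (weaken a∧b) (deduction var₁)))

  ⇔-intro : ∀ {Γ A B} → A ∷ Γ ⊩ B → B ∷ Γ ⊩ A → Γ ⊩ A ⇔ B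
  ⇔-intro ab ba = ∧-intro (deduction ab) (deduction ba)

  detach : ∀ {Γ} X Y → Γ ⊩ ⟦ X ⟧ Y → Γ ⊩ X → Γ ⊩ Y
  detach X Y xy x = app (app (thm (axT X Y)) xy) x

  push¬ : ∀ {Γ} X Y → Γ ⊩ ¬c (⟦ X ⟧ Y) → Γ ⊩ ⟦ X ⟧ (¬c Y)
  push¬ {Γ} X Y n = app pushing n
    where
    pushing : Γ ⊩ ¬c (⟦ X ⟧ Y) ⇒ ⟦ X ⟧ (¬c Y)
    pushing = ∧-elimʳ (⟦ X ⟧ (¬c Y) ⇒ ¬c (⟦ X ⟧ Y)) (¬c (⟦ X ⟧ Y) ⇒ ⟦ X ⟧ (¬c Y)) (thm (axN X Y))

  conditional⇒consequent : ∀ {Γ} X Y → Γ ⊩ X ∧c (⟦ X ⟧ Y) → Γ ⊩ X ∧c Y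
  conditional⇒consequent {Γ} X Y h = ∧-intro x (detach X Y (∧-elimʳ X (⟦ X ⟧ Y) h) x)
    where
    x : Γ ⊩ X
    x = ∧-elimˡ X (⟦ X ⟧ Y) h

  -- Right to left: if ¬[X]Y then [X]¬Y, so X would give ¬Y, contradicting Y.
  consequent⇒conditional : ∀ {Γ} X Y → Γ ⊩ X ∧c Y → Γ ⊩ X ∧c (⟦ X ⟧ Y)
  consequent⇒conditional {Γ} X Y h = ∧-intro (∧-elimˡ X Y h) (¬¬-elim (⟦ X ⟧ Y) (deduction refuted))
    where
    refuted : ¬c (⟦ X ⟧ Y) ∷ Γ ⊩ ⊥c
    refuted = app (detach X (¬c Y) (push¬ X Y var₀) (∧-elimˡ X Y (weaken h)))
                  (∧-elimʳ X Y (weaken h))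

mainTheorem17 : {Atom : Set} (X Y : Cond Atom) → ⊢ [ (X ∧c (⟦ X ⟧ Y)) ⇔ (X ∧c Y) ]
mainTheorem17 X Y =
  discharge (⇔-intro (conditional⇒consequent X Y var₀) (consequent⇒conditional X Y var₀))
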